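{- (i) If $\Gamma\vdash O:\phi$ in $\lambda Z$, then IZF${}_R^-+rg(\Gamma)\vdash\phi$, where $rg(\Gamma)=\{\phi\mid(x,\phi)\in\Gamma\}$. (ii) If $\Gamma$ is a finite set of formulas and IZF${}_R^-+\Gamma\vdash\phi$, then there is a $\lambda Z$ term $M$ such that $\overline{\Gamma}\vdash M:\phi$, where $\overline{\Gamma}=\{(x_\phi,\phi)\mid\phi\in\Gamma\}$ (distinct proof variables $x_\phi$).
   Context: IZF${}_R$: intuitionistic first-order logic without equality; binary relation $\in$; terms are variables, $\emptyset$, $\omega$, $\{t,u\}$, $\bigcup t$, $P(t)$, $S_{\phi(a,\vec f)}(t,\vec u)$, $R_{\phi(a,b,\vec f)}(t,\vec u)$ (one symbol per formula); formulas from $t\in u$, $\bot$ via $\land,\lor,\to,\forall,\exists$; $t=u$ means $\forall z.\ z\in t\leftrightarrow z\in u$, $0:=\emptyset$, $S(t):=\bigcup\{t,\{t,t\}\}$. Class axioms $\forall\vec a\,\forall c.\ c\in t_A(\vec a)\leftrightarrow\phi_A(c,\vec a)$: (EMPTY) $\emptyset$, $\bot$; (PAIR) $\{a,b\}$, $c=a\lor c=b$; (INF) $\omega$, $c=0\lor\exists b\in\omega.\ c=S(b)$; (SEP${}_\phi$) $S_{\phi(a,\vec f)}(a,\vec f)$, $c\in a\land\phi(c,\vec f)$; (UNION) $\bigcup a$, $\exists b\in a.\ c\in b$; (POWER) $P(a)$, $\forall b.\ b\in c\to b\in a$; (REPL${}_\phi$) $R_{\phi(a,b,\vec f)}(a,\vec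 f)$, $(\forall x\in a\,\exists!y.\ \phi(x,y,\vec f))\land\exists x\in a.\ \phi(x,c,\vec f)$; names ax $\in\{$empty, pair, inf, sep${}_\phi$, union, power, repl${}_\phi\}$. Further axioms: (IND${}_\phi$) $\forall\vec f.\ (\forall a.(\forall b\in a.\ \phi(b,\vec f))\to\phi(a,\vec f))\to\forall a.\ \phi(a,\vec f)$ and the Leibniz schema (L${}_\phi$) $\forall\vec f,a,b.\ a=b\to\phi(a,\vec f)\to\phi(b,\vec f)$. IZF${}_R^-$ consists of the class axioms and IND${}_\phi$ (no L${}_\phi$). $\lambda Z$ terms: $M::=x\mid M\,N\mid\lambda a.M\mid\lambda x:\phi.M\mid\mathrm{inl}(M)\mid\mathrm{inr}(M)\mid\mathrm{fst}(M)\mid\mathrm{snd}(M)\mid[t,M]\mid M\,t\mid\langle M,N\rangle\mid\mathrm{case}(M,x:\phi.N,x:\psi.O)\mid\mathrm{magic}(M)\mid\mathrm{let}\ [a,x:\phi]:=M\ \mathrm{in}\ N\mid\mathrm{axRep}(t,\vec u,M)\mid\mathrm{axProp}(t,\vec u,M)\mid\mathrm{ind}_{\phi(a,\vec b)}(\vec t,M)$. Typing ($\Gamma$ a finite set of declarations $x:\phi$): $\Gamma,x:\phi\vdash x:\phi$; $\to$: from $\Gamma,x:\phi\vdash M:\psi$ infer $\Gamma\vdash\lambda x:\phi.M:\phi\to\psi$, from $M:\phi\to\psi$, $N:\phi$ infer $M\,N:\psi$; $\land$: $\langle M,N\rangle:\phi\land\psi$ from $M:\phi,N:\psi$; $\mathrm{fst}(M):\phi$,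 $\mathrm{snd}(M):\psi$ from $M:\phi\land\psi$; $\lor$: $\mathrm{inl}(M):\phi\lor\psi$ from $M:\phi$, $\mathrm{inr}(M):\phi\lor\psi$ from $M:\psi$, $\Gamma\vdash\mathrm{case}(M,x:\phi.N,x:\psi.O):\vartheta$ from $\Gamma\vdash M:\phi\lor\psi$, $\Gamma,x:\phi\vdash N:\vartheta$, $\Gamma,x:\psi\vdash O:\vartheta$; $\forall$: $\Gamma\vdash\lambda a.M:\forall a.\phi$ from $\Gamma\vdash M:\phi$ if $a$ not free in $\Gamma$, $M\,t:\phi[a:=t]$ from $M:\forall a.\phi$; $\exists$: $[t,M]:\exists a.\phi$ from $M:\phi[a:=t]$, $\Gamma\vdash\mathrm{let}\ [a,x:\phi]:=M\ \mathrm{in}\ N:\psi$ from $\Gamma\vdash M:\exists a.\phi$, $\Gamma,x:\phi\vdash N:\psi$ if $a$ not free in $\Gamma,\psi$; $\mathrm{magic}(M):\phi$ from $M:\bot$; $\mathrm{axRep}(t,\vec u,M):t\in t_A(\vec u)$ from $M:\phi_A(t,\vec u)$; $\mathrm{axProp}(t,\vec u,M):\phi_A(t,\vec u)$ from $M:t\in t_A(\vec u)$; $\mathrm{ind}_{\phi(a,\vec f)}(\vec t,M):\forall a.\phi(a,\vec t)$ from $M:\forall c.(\forall b.\ b\in c\to\phi(b,\vec t))\to\phi(c,\vec t)$. -}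

module Defs where

open import Data.Nat using (ℕ; zero; suc)
open import Data.Fin using (Fin; zero; suc)
open import Data.Vec using (Vec; []; _∷_; lookup; tabulate)
open import Data.List using (List; []; _∷_; map)
open import Data.List.Membership.Propositional using (_∈_)

-- Syntax of IZF_R (de Bruijn, scoped: Term n / Formula n have free
-- individual variables among Fin n; variable 0 is the innermost binder).

infixr 6 _∧'_
infixr 5 _∨'_
infixr 4 _⇒_ _⇔_
infix 7 _∈'_

mutual
  data Term (n : ℕ) : Set where
    var   : Fin n → Term n
    ∅     : Term n
    ω     : Term n
    ｛_,_｝ : Term n → Term n → Term n
    ⋃     : Term n → Term n
    𝒫     : Term n → Term n
    -- S_{φ(a, f1..fk)}(t, u1..uk); in φ, var 0 = a, var (suc i) = f_i
    Sep   : (k : ℕ) → Formula (suc k) → Term n → Vec (Term n) k → Term n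
    -- R_{φ(a, b, f1..fk)}(t, u1..uk); in φ, var 0 = a, var 1 = b,
    -- var (suc (suc i)) = f_i
    Repl  : (k : ℕ) → Formula (suc (suc k)) → Term n → Vec (Term n) k → Term n

  data Formula : ℕ → Set where
    _∈'_ : ∀ {n} → Term n → Term n → Formula n
    ⊥'   : ∀ {n} → Formula n
    _∧'_ : ∀ {n} → Formula n → Formula n → Formula n
    _∨'_ : ∀ {n} → Formula n → Formula n → Formula n
    _⇒_  : ∀ {n} → Formula n → Formula n → Formula n
    ∀'   : ∀ {n} → Formula (suc n) → Formula n
    ∃'   : ∀ {n} → Formula (suc n) → Formula n

-- Renaming and substitution (the formula indexing a Sep/Repl symbol is
-- part of the symbol and is not touched).

Ren : ℕ → ℕ → Set
Ren m n = Fin m → Fin n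

extR : ∀ {m n} → Ren m n → Ren (suc m) (suc n)
extR ρ zero    = zero
extR ρ (suc i) = suc (ρ i)

mutual
  renT : ∀ {m n} → Ren m n → Term m → Term n
  renT ρ (var i)        = var (ρ i)
  renT ρ ∅              = ∅
  renT ρ ω              = ω
  renT ρ ｛ t , u ｝      = ｛ renT ρ t , renT ρ u ｝
  renT ρ (⋃ t)          = ⋃ (renT ρ t)
  renT ρ (𝒫 t)          = 𝒫 (renT ρ t)
  renT ρ (Sep k φ t us)  = Sep k φ (renT ρ t) (renTs ρ us)
  renT ρ (Repl k φ t us) = Repl k φ (renT ρ t) (renTs ρ us)

  renTs : ∀ {m n k} → Ren m n → Vec (Term m) k → Vec (Term n) k
  renTs ρ []       = []
  renTs ρ (t ∷ ts) = renT ρ t ∷ renTs ρ ts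

renF : ∀ {m n} → Ren m n → Formula m → Formula n
renF ρ (t ∈' u) = renT ρ t ∈' renT ρ u
renF ρ ⊥'       = ⊥'
renF ρ (φ ∧' ψ) = renF ρ φ ∧' renF ρ ψ
renF ρ (φ ∨' ψ) = renF ρ φ ∨' renF ρ ψ
renF ρ (φ ⇒ ψ)  = renF ρ φ ⇒ renF ρ ψ
renF ρ (∀' φ)   = ∀' (renF (extR ρ) φ)
renF ρ (∃' φ)   = ∃' (renF (extR ρ) φ)

Sub : ℕ → ℕ → Set
Sub m n = Fin m → Term n

extS : ∀ {m n} → Sub m n → Sub (suc m) (suc n)
extS σ zero    = var zero
extS σ (suc i) = renT suc (σ i)

mutual
  subT : ∀ {m n} → Sub m n → Term m → Term n
  subT σ (var i)        = σ i
  subT σ ∅              = ∅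
  subT σ ω              = ω
  subT σ ｛ t , u ｝      = ｛ subT σ t , subT σ u ｝
  subT σ (⋃ t)          = ⋃ (subT σ t)
  subT σ (𝒫 t)          = 𝒫 (subT σ t)
  subT σ (Sep k φ t us)  = Sep k φ (subT σ t) (subTs σ us)
  subT σ (Repl k φ t us) = Repl k φ (subT σ t) (subTs σ us)

  subTs : ∀ {m n k} → Sub m n → Vec (Term m) k → Vec (Term n) k
  subTs σ []       = []
  subTs σ (t ∷ ts) = subT σ t ∷ subTs σ ts

subF : ∀ {m n} → Sub m n → Formula m → Formula n
subF σ (t ∈' u) = subT σ t ∈' subT σ u
subF σ ⊥'       = ⊥'
subF σ (φ ∧' ψ) = subF σ φ ∧' subF σ ψ
subF σ (φ ∨' ψ) = subF σ φ ∨' subF σ ψ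
subF σ (φ ⇒ ψ)  = subF σ φ ⇒ subF σ ψ
subF σ (∀' φ)   = ∀' (subF (extS σ) φ)
subF σ (∃' φ)   = ∃' (subF (extS σ) φ)

wkF : ∀ {n} → Formula n → Formula (suc n)
wkF = renF suc

wkCtx : ∀ {n} → List (Formula n) → List (Formula (suc n))
wkCtx = map wkF

_[_] : ∀ {n} → Formula (suc n) → Term n → Formula n
φ [ t ] = subF σ φ
  where
  σ : Sub _ _
  σ zero    = t
  σ (suc i) = var i

closeF : ∀ {n} → Formula 0 → Formula n
closeF = renF (λ ())

inst : ∀ {n k} → Formula (suc k) → Term n → Vec (Term n) k → Formula n
inst φ t us = subF σ φ
  where
  σ : Sub _ _
  σ zero    = t
  σ (suc i) = lookup us i

_⇔_ : ∀ {n} → Formula n → Formula n → Formula n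
φ ⇔ ψ = (φ ⇒ ψ) ∧' (ψ ⇒ φ)

_≐_ : ∀ {n} → Term n → Term n → Formula n
t ≐ u = ∀' (var zero ∈' renT suc t ⇔ var zero ∈' renT suc u)

Sc : ∀ {n} → Term n → Term n
Sc t = ⋃ ｛ t , ｛ t , t ｝ ｝

∃!' : ∀ {n} → Formula (suc n) → Formula n
∃!' ψ = ∃' (ψ ∧' ∀' (renF (extR suc) ψ ⇒ var zero ≐ var (suc zero)))

∀^ : (k : ℕ) → Formula k → Formula 0
∀^ zero    φ = φ
∀^ (suc k) φ = ∀^ k (∀' φ)

data Ax : Set where
  empty pair inf union power : Ax
  sep  : (k : ℕ) → Formula (suc k) → Ax
  repl : (k : ℕ) → Formula (suc (suc k)) → Ax

arity : Ax → ℕ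
arity empty      = 0
arity pair       = 2
arity inf        = 0
arity union      = 1
arity power      = 1
arity (sep k φ)  = suc k
arity (repl k φ) = suc k

tA : ∀ {n} (A : Ax) → Vec (Term n) (arity A) → Term n
tA empty      []            = ∅
tA pair       (a ∷ b ∷ [])  = ｛ a , b ｝
tA inf        []            = ω
tA union      (a ∷ [])      = ⋃ a
tA power      (a ∷ [])      = 𝒫 a
tA (sep k φ)  (a ∷ fs)      = Sep k φ a fs
tA (repl k φ) (a ∷ fs)      = Repl k φ a fs

private
  v : ∀ {n} → Fin n → Term n
  v = var
  f0 f1 f2 f3 f4 : ∀ {n} → Fin (suc (suc (suc (suc (suc n)))))
  f0 = zero
  f1 = suc zero
  f2 = suc (suc zero)
  f3 = suc (suc (suc zero))
  f4 = suc (suc (suc (suc zero)))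

-- φ_A(c, a⃗): variable 0 = c, variable (suc i) = a_i
φA : (A : Ax) → Formula (suc (arity A))
φA empty = ⊥'
φA pair  = (var zero ≐ var (suc zero)) ∨' (var zero ≐ var (suc (suc zero)))
φA inf   = (var zero ≐ ∅)
           ∨' ∃' ((var zero ∈' ω) ∧' (var (suc zero) ≐ Sc (var zero)))
           -- under ∃: b = 0, c = 1
φA union = ∃' ((var zero ∈' var (suc (suc zero))) ∧' (var (suc zero) ∈' var zero))
           -- under ∃: b = 0, c = 1, a = 2
φA power = ∀' ((var zero ∈' var (suc zero)) ⇒ (var zero ∈' var (suc (suc zero))))
           -- under ∀: b = 0, c = 1, a = 2
φA (sep k φ) = (var zero ∈' var (suc zero)) ∧' subF σ φ
  where
  -- scope: c = 0, a = 1, f_i = 2 + i ;  φ(c, f⃗)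
  σ : Sub (suc k) (suc (suc k))
  σ zero    = var zero
  σ (suc i) = var (suc (suc i))
φA (repl k φ) =
  ∀' ((var zero ∈' var (suc (suc zero))) ⇒ ∃!' (subF σ₁ φ))
  ∧' ∃' ((var zero ∈' var (suc (suc zero))) ∧' subF σ₂ φ)
  where
  -- inside ∀x ∃y: y = 0, x = 1, c = 2, a = 3, f_i = 4 + i ; φ(x, y, f⃗)
  σ₁ : Sub (suc (suc k)) (suc (suc (suc (suc k))))
  σ₁ zero          = var (suc zero)
  σ₁ (suc zero)    = var zero
  σ₁ (suc (suc i)) = var (suc (suc (suc (suc i))))
  -- inside ∃x: x = 0, c = 1, a = 2, f_i = 3 + i ; φ(x, c, f⃗)
  σ₂ : Sub (suc (suc k)) (suc (suc (suc k)))
  σ₂ zero          = var zero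
  σ₂ (suc zero)    = var (suc zero)
  σ₂ (suc (suc i)) = var (suc (suc (suc i)))

classAxiom : Ax → Formula 0
classAxiom A = ∀^ (arity A) (∀' ((var zero ∈' tA A (tabulate (λ i → var (suc i)))) ⇔ φA A))

indPremise : ∀ {n} → Formula (suc n) → Formula n
indPremise ψ = ∀' (∀' ((var zero ∈' var (suc zero)) ⇒ renF (extR suc) ψ) ⇒ ψ)

-- IND_φ : ∀f⃗. (∀a. (∀b∈a. φ(b, f⃗)) → φ(a, f⃗)) → ∀a. φ(a, f⃗)
-- φ : Formula (suc k), variable 0 = a, variable (suc i) = f_i
indAxiom : (k : ℕ) → Formula (suc k) → Formula 0
indAxiom k φ = ∀^ k (indPremise φ ⇒ ∀' φ)

-- the axioms of IZF_R^- (class axioms and IND, no Leibniz schema)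
data Axiom : Set where
  cls : Ax → Axiom
  ind : (k : ℕ) → Formula (suc k) → Axiom

axiomF : Axiom → Formula 0
axiomF (cls A)   = classAxiom A
axiomF (ind k φ) = indAxiom k φ

infix 2 _⊢_

data _⊢_ {n : ℕ} (Γ : List (Formula n)) : Formula n → Set where
  hyp   : ∀ {φ} → φ ∈ Γ → Γ ⊢ φ
  axiom : (A : Axiom) → Γ ⊢ closeF (axiomF A)
  ⇒I    : ∀ {φ ψ} → (φ ∷ Γ) ⊢ ψ → Γ ⊢ φ ⇒ ψ
  ⇒E    : ∀ {φ ψ} → Γ ⊢ φ ⇒ ψ → Γ ⊢ φ → Γ ⊢ ψ
  ∧I    : ∀ {φ ψ} → Γ ⊢ φ → Γ ⊢ ψ → Γ ⊢ φ ∧' ψ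
  ∧E₁   : ∀ {φ ψ} → Γ ⊢ φ ∧' ψ → Γ ⊢ φ
  ∧E₂   : ∀ {φ ψ} → Γ ⊢ φ ∧' ψ → Γ ⊢ ψ
  ∨I₁   : ∀ {φ ψ} → Γ ⊢ φ → Γ ⊢ φ ∨' ψ
  ∨I₂   : ∀ {φ ψ} → Γ ⊢ ψ → Γ ⊢ φ ∨' ψ
  ∨E    : ∀ {φ ψ ϑ} → Γ ⊢ φ ∨' ψ → (φ ∷ Γ) ⊢ ϑ → (ψ ∷ Γ) ⊢ ϑ → Γ ⊢ ϑ
  ⊥E    : ∀ {φ} → Γ ⊢ ⊥' → Γ ⊢ φ
  ∀I    : ∀ {φ} → wkCtx Γ ⊢ φ → Γ ⊢ ∀' φ
  ∀E    : ∀ {φ} → Γ ⊢ ∀' φ → (t : Term n) → Γ ⊢ φ [ t ]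
  ∃I    : ∀ {φ} → (t : Term n) → Γ ⊢ φ [ t ] → Γ ⊢ ∃' φ
  ∃E    : ∀ {φ ψ} → Γ ⊢ ∃' φ → (φ ∷ wkCtx Γ) ⊢ wkF ψ → Γ ⊢ ψ

-- λZ terms (proof variables as de Bruijn indices into the context)

data PTerm (n : ℕ) : Set where
  pvar   : ℕ → PTerm n
  app    : PTerm n → PTerm n → PTerm n
  ilam   : PTerm (suc n) → PTerm n
  plam   : Formula n → PTerm n → PTerm n
  inl    : PTerm n → PTerm n
  inr    : PTerm n → PTerm n
  fst    : PTerm n → PTerm n
  snd    : PTerm n → PTerm n
  pack   : Term n → PTerm n → PTerm n
  iapp   : PTerm n → Term n → PTerm n
  pair   : PTerm n → PTerm n → PTerm n
  case   : PTerm n → Formula n → PTerm n → Formula n → PTerm n → PTerm n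
  magic  : PTerm n → PTerm n
  let∃   : Formula (suc n) → PTerm n → PTerm (suc n) → PTerm n
  axRep  : (A : Ax) → Term n → Vec (Term n) (arity A) → PTerm n → PTerm n
  axProp : (A : Ax) → Term n → Vec (Term n) (arity A) → PTerm n → PTerm n
  indP   : (k : ℕ) → Formula (suc k) → Vec (Term n) k → PTerm n → PTerm n

data Lookup {n : ℕ} : List (Formula n) → ℕ → Formula n → Set where
  here  : ∀ {Γ φ} → Lookup (φ ∷ Γ) zero φ
  there : ∀ {Γ φ ψ x} → Lookup Γ x φ → Lookup (ψ ∷ Γ) (suc x) φ

instUnder : ∀ {n k} → Formula (suc k) → Vec (Term n) k → Formula (suc n)
instUnder φ ts = inst φ (var zero) (renTs suc ts)

infix 2 _⊢λ_∶_

data _⊢λ_∶_ {n : ℕ} (Γ : List (Formula n)) : PTerm n → Formula n → Set where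
  tvar   : ∀ {x φ} → Lookup Γ x φ → Γ ⊢λ pvar x ∶ φ
  tplam  : ∀ {φ ψ M} → (φ ∷ Γ) ⊢λ M ∶ ψ → Γ ⊢λ plam φ M ∶ φ ⇒ ψ
  tapp   : ∀ {φ ψ M N} → Γ ⊢λ M ∶ φ ⇒ ψ → Γ ⊢λ N ∶ φ → Γ ⊢λ app M N ∶ ψ
  tpair  : ∀ {φ ψ M N} → Γ ⊢λ M ∶ φ → Γ ⊢λ N ∶ ψ → Γ ⊢λ pair M N ∶ φ ∧' ψ
  tfst   : ∀ {φ ψ M} → Γ ⊢λ M ∶ φ ∧' ψ → Γ ⊢λ fst M ∶ φ
  tsnd   : ∀ {φ ψ M} → Γ ⊢λ M ∶ φ ∧' ψ → Γ ⊢λ snd M ∶ ψ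
  tinl   : ∀ {φ ψ M} → Γ ⊢λ M ∶ φ → Γ ⊢λ inl M ∶ φ ∨' ψ
  tinr   : ∀ {φ ψ M} → Γ ⊢λ M ∶ ψ → Γ ⊢λ inr M ∶ φ ∨' ψ
  tcase  : ∀ {φ ψ ϑ M N O} → Γ ⊢λ M ∶ φ ∨' ψ → (φ ∷ Γ) ⊢λ N ∶ ϑ
           → (ψ ∷ Γ) ⊢λ O ∶ ϑ → Γ ⊢λ case M φ N ψ O ∶ ϑ
  tilam  : ∀ {φ M} → wkCtx Γ ⊢λ M ∶ φ → Γ ⊢λ ilam M ∶ ∀' φ
  tiapp  : ∀ {φ M} → Γ ⊢λ M ∶ ∀' φ → (t : Term n) → Γ ⊢λ iapp M t ∶ φ [ t ]
  tpack  : ∀ {φ M} → (t : Term n) → Γ ⊢λ M ∶ φ [ t ] → Γ ⊢λ pack t M ∶ ∃' φ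
  tlet   : ∀ {φ ψ M N} → Γ ⊢λ M ∶ ∃' φ → (φ ∷ wkCtx Γ) ⊢λ N ∶ wkF ψ
           → Γ ⊢λ let∃ φ M N ∶ ψ
  tmagic : ∀ {φ M} → Γ ⊢λ M ∶ ⊥' → Γ ⊢λ magic M ∶ φ
  taxRep : ∀ {M} (A : Ax) (t : Term n) (us : Vec (Term n) (arity A))
           → Γ ⊢λ M ∶ inst (φA A) t us → Γ ⊢λ axRep A t us M ∶ t ∈' tA A us
  taxProp : ∀ {M} (A : Ax) (t : Term n) (us : Vec (Term n) (arity A))
           → Γ ⊢λ M ∶ t ∈' tA A us → Γ ⊢λ axProp A t us M ∶ inst (φA A) t us
  tind   : ∀ {M} (k : ℕ) (φ : Formula (suc k)) (ts : Vec (Term n) k)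
           → Γ ⊢λ M ∶ indPremise (instUnder φ ts)
           → Γ ⊢λ indP k φ ts M ∶ ∀' (instUnder φ ts)

-- Both directions are inductions on derivations, since every typing rule of λZ is a natural
-- deduction rule read through Curry–Howard.  The only rules without a logical counterpart are
-- axRep/axProp, which are the two directions of an instance of a class axiom, and ind, which is
-- modus ponens with an instance of IND.  Conversely each axiom of IZF_R^- has the proof term
-- λa⃗. λc. ⟨λx. axProp(c, a⃗, x), λx. axRep(c, a⃗, x)⟩, respectively λf⃗. λx. ind(f⃗, x).
-- The instance of an axiom at a⃗ arises from the closed axiom by ∀-elimination at each a_i in
-- turn, so the rest is substitution bookkeeping.
module Submission where

open import Defs
open import Data.Nat using (ℕ; zero; suc)
open import Data.Fin using (Fin; zero; suc)
open import Data.List using (List)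
open import Data.List.Membership.Propositional using (_∈_)
open import Data.List.Relation.Unary.Any using (here; there)
open import Data.Product using (Σ; _×_; _,_)
open import Data.Vec using (Vec; []; _∷_; lookup; tabulate)
open import Data.Vec.Properties using (lookup∘tabulate; tabulate∘lookup; tabulate-cong)
open import Function using (_∘_)
open import Relation.Binary.PropositionalEquality
  using (_≡_; refl; sym; trans; cong; cong₂; subst; _≗_; module ≡-Reasoning)

mutual
  subT-cong : ∀ {m n} {σ σ′ : Sub m n} → σ ≗ σ′ → subT σ ≗ subT σ′
  subT-cong h (var i)         = h i
  subT-cong h ∅               = refl
  subT-cong h ω               = refl
  subT-cong h ｛ t , u ｝       = cong₂ ｛_,_｝ (subT-cong h t) (subT-cong h u)
  subT-cong h (⋃ t)           = cong ⋃ (subT-cong h t)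
  subT-cong h (𝒫 t)           = cong 𝒫 (subT-cong h t)
  subT-cong h (Sep k φ t us)  = cong₂ (Sep k φ) (subT-cong h t) (subTs-cong h us)
  subT-cong h (Repl k φ t us) = cong₂ (Repl k φ) (subT-cong h t) (subTs-cong h us)

  subTs-cong : ∀ {m n k} {σ σ′ : Sub m n} → σ ≗ σ′ → subTs {k = k} σ ≗ subTs σ′
  subTs-cong h []       = refl
  subTs-cong h (t ∷ ts) = cong₂ _∷_ (subT-cong h t) (subTs-cong h ts)

mutual
  renT≡subT : ∀ {m n} (ρ : Ren m n) → renT ρ ≗ subT (var ∘ ρ)
  renT≡subT ρ (var i)         = refl
  renT≡subT ρ ∅               = refl
  renT≡subT ρ ω               = refl
  renT≡subT ρ ｛ t , u ｝       = cong₂ ｛_,_｝ (renT≡subT ρ t) (renT≡subT ρ u)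
  renT≡subT ρ (⋃ t)           = cong ⋃ (renT≡subT ρ t)
  renT≡subT ρ (𝒫 t)           = cong 𝒫 (renT≡subT ρ t)
  renT≡subT ρ (Sep k φ t us)  = cong₂ (Sep k φ) (renT≡subT ρ t) (renTs≡subTs ρ us)
  renT≡subT ρ (Repl k φ t us) = cong₂ (Repl k φ) (renT≡subT ρ t) (renTs≡subTs ρ us)

  renTs≡subTs : ∀ {m n k} (ρ : Ren m n) → renTs {k = k} ρ ≗ subTs (var ∘ ρ)
  renTs≡subTs ρ []       = refl
  renTs≡subTs ρ (t ∷ ts) = cong₂ _∷_ (renT≡subT ρ t) (renTs≡subTs ρ ts)

mutual
  subT-id : ∀ {n} (t : Term n) → subT var t ≡ t
  subT-id (var i)         = refl
  subT-id ∅               = refl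
  subT-id ω               = refl
  subT-id ｛ t , u ｝       = cong₂ ｛_,_｝ (subT-id t) (subT-id u)
  subT-id (⋃ t)           = cong ⋃ (subT-id t)
  subT-id (𝒫 t)           = cong 𝒫 (subT-id t)
  subT-id (Sep k φ t us)  = cong₂ (Sep k φ) (subT-id t) (subTs-id us)
  subT-id (Repl k φ t us) = cong₂ (Repl k φ) (subT-id t) (subTs-id us)

  subTs-id : ∀ {n k} (ts : Vec (Term n) k) → subTs var ts ≡ ts
  subTs-id []       = refl
  subTs-id (t ∷ ts) = cong₂ _∷_ (subT-id t) (subTs-id ts)

-- Terms bind no variables (the formula of a Sep/Repl symbol is not substituted into), so
-- composition of substitutions needs no lifting here.
mutual
  subT-subT : ∀ {l m n} (τ : Sub m n) (σ : Sub l m) → subT τ ∘ subT σ ≗ subT (subT τ ∘ σ)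
  subT-subT τ σ (var i)         = refl
  subT-subT τ σ ∅               = refl
  subT-subT τ σ ω               = refl
  subT-subT τ σ ｛ t , u ｝       = cong₂ ｛_,_｝ (subT-subT τ σ t) (subT-subT τ σ u)
  subT-subT τ σ (⋃ t)           = cong ⋃ (subT-subT τ σ t)
  subT-subT τ σ (𝒫 t)           = cong 𝒫 (subT-subT τ σ t)
  subT-subT τ σ (Sep k φ t us)  = cong₂ (Sep k φ) (subT-subT τ σ t) (subTs-subTs τ σ us)
  subT-subT τ σ (Repl k φ t us) = cong₂ (Repl k φ) (subT-subT τ σ t) (subTs-subTs τ σ us)

  subTs-subTs : ∀ {l m n k} (τ : Sub m n) (σ : Sub l m)
              → subTs {k = k} τ ∘ subTs σ ≗ subTs (subT τ ∘ σ)
  subTs-subTs τ σ []       = refl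
  subTs-subTs τ σ (t ∷ ts) = cong₂ _∷_ (subT-subT τ σ t) (subTs-subTs τ σ ts)

subT-renT : ∀ {l m n} (σ : Sub m n) (ρ : Ren l m) → subT σ ∘ renT ρ ≗ subT (σ ∘ ρ)
subT-renT σ ρ t = trans (cong (subT σ) (renT≡subT ρ t)) (subT-subT σ (var ∘ ρ) t)

renT-subT : ∀ {l m n} (ρ : Ren m n) (σ : Sub l m) → renT ρ ∘ subT σ ≗ subT (renT ρ ∘ σ)
renT-subT ρ σ t = begin
  renT ρ (subT σ t)            ≡⟨ renT≡subT ρ (subT σ t) ⟩
  subT (var ∘ ρ) (subT σ t)    ≡⟨ subT-subT (var ∘ ρ) σ t ⟩
  subT (subT (var ∘ ρ) ∘ σ) t  ≡⟨ subT-cong (λ i → sym (renT≡subT ρ (σ i))) t ⟩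
  subT (renT ρ ∘ σ) t          ∎
  where open ≡-Reasoning

renT-renT : ∀ {l m n} (ρ : Ren m n) (ρ′ : Ren l m) → renT ρ ∘ renT ρ′ ≗ renT (ρ ∘ ρ′)
renT-renT ρ ρ′ t = begin
  renT ρ (renT ρ′ t)          ≡⟨ cong (renT ρ) (renT≡subT ρ′ t) ⟩
  renT ρ (subT (var ∘ ρ′) t)  ≡⟨ renT-subT ρ (var ∘ ρ′) t ⟩
  subT (var ∘ ρ ∘ ρ′) t       ≡⟨ sym (renT≡subT (ρ ∘ ρ′) t) ⟩
  renT (ρ ∘ ρ′) t             ∎
  where open ≡-Reasoning

extS-cong : ∀ {m n} {σ σ′ : Sub m n} → σ ≗ σ′ → extS σ ≗ extS σ′
extS-cong h zero    = refl
extS-cong h (suc i) = cong (renT suc) (h i)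

subF-cong : ∀ {m n} {σ σ′ : Sub m n} → σ ≗ σ′ → subF σ ≗ subF σ′
subF-cong h (t ∈' u) = cong₂ _∈'_ (subT-cong h t) (subT-cong h u)
subF-cong h ⊥'       = refl
subF-cong h (φ ∧' ψ) = cong₂ _∧'_ (subF-cong h φ) (subF-cong h ψ)
subF-cong h (φ ∨' ψ) = cong₂ _∨'_ (subF-cong h φ) (subF-cong h ψ)
subF-cong h (φ ⇒ ψ)  = cong₂ _⇒_ (subF-cong h φ) (subF-cong h ψ)
subF-cong h (∀' φ)   = cong ∀' (subF-cong (extS-cong h) φ)
subF-cong h (∃' φ)   = cong ∃' (subF-cong (extS-cong h) φ)

var∘extR : ∀ {m n} (ρ : Ren m n) → var ∘ extR ρ ≗ extS (var ∘ ρ)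
var∘extR ρ zero    = refl
var∘extR ρ (suc i) = refl

renF≡subF : ∀ {m n} (ρ : Ren m n) → renF ρ ≗ subF (var ∘ ρ)
renF≡subF ρ (t ∈' u) = cong₂ _∈'_ (renT≡subT ρ t) (renT≡subT ρ u)
renF≡subF ρ ⊥'       = refl
renF≡subF ρ (φ ∧' ψ) = cong₂ _∧'_ (renF≡subF ρ φ) (renF≡subF ρ ψ)
renF≡subF ρ (φ ∨' ψ) = cong₂ _∨'_ (renF≡subF ρ φ) (renF≡subF ρ ψ)
renF≡subF ρ (φ ⇒ ψ)  = cong₂ _⇒_ (renF≡subF ρ φ) (renF≡subF ρ ψ)
renF≡subF ρ (∀' φ)   = cong ∀' (trans (renF≡subF (extR ρ) φ) (subF-cong (var∘extR ρ) φ))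
renF≡subF ρ (∃' φ)   = cong ∃' (trans (renF≡subF (extR ρ) φ) (subF-cong (var∘extR ρ) φ))

subT-extS-extS : ∀ {l m n} (τ : Sub m n) (σ : Sub l m) → subT (extS τ) ∘ extS σ ≗ extS (subT τ ∘ σ)
subT-extS-extS τ σ zero    = refl
subT-extS-extS τ σ (suc i) = trans (subT-renT (extS τ) suc (σ i)) (sym (renT-subT suc τ (σ i)))

subF-subF : ∀ {l m n} (τ : Sub m n) (σ : Sub l m) → subF τ ∘ subF σ ≗ subF (subT τ ∘ σ)
subF-subF τ σ (t ∈' u) = cong₂ _∈'_ (subT-subT τ σ t) (subT-subT τ σ u)
subF-subF τ σ ⊥'       = refl
subF-subF τ σ (φ ∧' ψ) = cong₂ _∧'_ (subF-subF τ σ φ) (subF-subF τ σ ψ)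
subF-subF τ σ (φ ∨' ψ) = cong₂ _∨'_ (subF-subF τ σ φ) (subF-subF τ σ ψ)
subF-subF τ σ (φ ⇒ ψ)  = cong₂ _⇒_ (subF-subF τ σ φ) (subF-subF τ σ ψ)
subF-subF τ σ (∀' φ)   =
  cong ∀' (trans (subF-subF (extS τ) (extS σ) φ) (subF-cong (subT-extS-extS τ σ) φ))
subF-subF τ σ (∃' φ)   =
  cong ∃' (trans (subF-subF (extS τ) (extS σ) φ) (subF-cong (subT-extS-extS τ σ) φ))

subF-renF : ∀ {l m n} (σ : Sub m n) (ρ : Ren l m) → subF σ ∘ renF ρ ≗ subF (σ ∘ ρ)
subF-renF σ ρ φ = trans (cong (subF σ) (renF≡subF ρ φ)) (subF-subF σ (var ∘ ρ) φ)

renF-subF : ∀ {l m n} (ρ : Ren m n) (σ : Sub l m) → renF ρ ∘ subF σ ≗ subF (renT ρ ∘ σ)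
renF-subF ρ σ φ = begin
  renF ρ (subF σ φ)            ≡⟨ renF≡subF ρ (subF σ φ) ⟩
  subF (var ∘ ρ) (subF σ φ)    ≡⟨ subF-subF (var ∘ ρ) σ φ ⟩
  subF (subT (var ∘ ρ) ∘ σ) φ  ≡⟨ subF-cong (λ i → sym (renT≡subT ρ (σ i))) φ ⟩
  subF (renT ρ ∘ σ) φ          ∎
  where open ≡-Reasoning

closeF≡subF : ∀ {n} (σ : Sub 0 n) → closeF ≗ subF σ
closeF≡subF σ φ = trans (renF≡subF (λ ()) φ) (subF-cong (λ ()) φ)

lookup-renTs : ∀ {m n k} (ρ : Ren m n) (ts : Vec (Term m) k) i
             → lookup (renTs ρ ts) i ≡ renT ρ (lookup ts i)
lookup-renTs ρ (t ∷ ts) zero    = refl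
lookup-renTs ρ (t ∷ ts) (suc i) = lookup-renTs ρ ts i

subTs-tabulate : ∀ {m n k} (σ : Sub m n) (f : Fin k → Term m)
               → subTs σ (tabulate f) ≡ tabulate (subT σ ∘ f)
subTs-tabulate {k = zero}  σ f = refl
subTs-tabulate {k = suc k} σ f = cong (subT σ (f zero) ∷_) (subTs-tabulate σ (f ∘ suc))

sub₀ : ∀ {n} → Term n → Sub (suc n) n
sub₀ t zero    = t
sub₀ t (suc i) = var i

[]≡subF-sub₀ : ∀ {n} (φ : Formula (suc n)) t → φ [ t ] ≡ subF (sub₀ t) φ
[]≡subF-sub₀ φ t = subF-cong (λ { zero → refl ; (suc i) → refl }) φ

subF-extS-[] : ∀ {k n} (σ : Sub (suc k) n) (φ : Formula (suc k))
             → subF (extS (σ ∘ suc)) φ [ σ zero ] ≡ subF σ φ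
subF-extS-[] σ φ = begin
  subF (extS (σ ∘ suc)) φ [ σ zero ]                      ≡⟨ []≡subF-sub₀ _ (σ zero) ⟩
  subF (sub₀ (σ zero)) (subF (extS (σ ∘ suc)) φ)          ≡⟨ subF-subF _ _ φ ⟩
  subF (subT (sub₀ (σ zero)) ∘ extS (σ ∘ suc)) φ          ≡⟨ subF-cong instantiated φ ⟩
  subF σ φ                                                ∎
  where
  open ≡-Reasoning
  instantiated : subT (sub₀ (σ zero)) ∘ extS (σ ∘ suc) ≗ σ
  instantiated zero    = refl
  instantiated (suc i) = trans (subT-renT (sub₀ (σ zero)) suc (σ (suc i))) (subT-id (σ (suc i)))

∀^-elim : ∀ k (φ : Formula k) {n} {Γ : List (Formula n)}
        → Γ ⊢ closeF (∀^ k φ) → (σ : Sub k n) → Γ ⊢ subF σ φ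
∀^-elim zero    φ {Γ = Γ} d σ = subst (Γ ⊢_) (closeF≡subF σ φ) d
∀^-elim (suc k) φ {Γ = Γ} d σ =
  subst (Γ ⊢_) (subF-extS-[] σ φ) (∀E (∀^-elim k (∀' φ) d (σ ∘ suc)) (σ zero))

Typable : ∀ {n} → List (Formula n) → Formula n → Set
Typable {n} Γ φ = Σ (PTerm n) λ M → Γ ⊢λ M ∶ φ

TypableInstances : ∀ k → Formula k → Set
TypableInstances k φ = ∀ {n} (Γ : List (Formula n)) (σ : Sub k n) → Typable Γ (subF σ φ)

∀^-typable : ∀ k (φ : Formula k) → TypableInstances k φ
           → ∀ {n} (Γ : List (Formula n)) → Typable Γ (closeF (∀^ k φ))
∀^-typable zero    φ p Γ = subst (Typable Γ) (sym (closeF≡subF (λ ()) φ)) (p Γ (λ ()))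
∀^-typable (suc k) φ p   = ∀^-typable k (∀' φ) λ Γ σ →
  let (M , ⊢M) = p (wkCtx Γ) (extS σ) in ilam M , tilam ⊢M

subT-tA : ∀ A {m n} (σ : Sub m n) vs → subT σ (tA A vs) ≡ tA A (subTs σ vs)
subT-tA empty      σ []           = refl
subT-tA pair       σ (a ∷ b ∷ []) = refl
subT-tA inf        σ []           = refl
subT-tA union      σ (a ∷ [])     = refl
subT-tA power      σ (a ∷ [])     = refl
subT-tA (sep k φ)  σ (a ∷ fs)     = refl
subT-tA (repl k φ) σ (a ∷ fs)     = refl

-- classAxiom A is ∀^ (suc (arity A)) (classAxiomBody A) by unfolding ∀^ once.
classAxiomBody : (A : Ax) → Formula (suc (arity A))
classAxiomBody A = (var zero ∈' tA A (tabulate (var ∘ suc))) ⇔ φA A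

subF-classAxiomBody : ∀ A {n} {σ : Sub (suc (arity A)) n} {t us} → σ ≗ lookup (t ∷ us)
                    → subF σ (classAxiomBody A) ≡ ((t ∈' tA A us) ⇔ inst (φA A) t us)
subF-classAxiomBody A {σ = σ} {t} {us} σ≗ =
  cong₂ (λ χ ϑ → (χ ⇒ ϑ) ∧' (ϑ ⇒ χ)) membership (subF-cong defining-formula (φA A))
  where
  parameters : subTs σ (tabulate (var ∘ suc)) ≡ us
  parameters = trans (subTs-tabulate σ (var ∘ suc))
                     (trans (tabulate-cong (σ≗ ∘ suc)) (tabulate∘lookup us))
  membership : subT σ (var zero) ∈' subT σ (tA A (tabulate (var ∘ suc))) ≡ t ∈' tA A us
  membership = cong₂ _∈'_ (σ≗ zero) (trans (subT-tA A σ _) (cong (tA A) parameters))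
  defining-formula : ∀ i → σ i ≡ _
  defining-formula zero    = σ≗ zero
  defining-formula (suc i) = σ≗ (suc i)

subF-indPremise : ∀ {m n} (σ : Sub m n) (ψ : Formula (suc m))
                → subF σ (indPremise ψ) ≡ indPremise (subF (extS σ) ψ)
subF-indPremise σ ψ =
  cong (λ χ → ∀' (∀' ((var zero ∈' var (suc zero)) ⇒ χ) ⇒ subF (extS σ) ψ)) weaken-under-binder
  where
  lifts-commute : extS (extS σ) ∘ extR suc ≗ renT (extR suc) ∘ extS σ
  lifts-commute zero    = refl
  lifts-commute (suc i) = trans (renT-renT suc suc (σ i)) (sym (renT-renT (extR suc) suc (σ i)))
  weaken-under-binder : subF (extS (extS σ)) (renF (extR suc) ψ) ≡ renF (extR suc) (subF (extS σ) ψ)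
  weaken-under-binder = trans (subF-renF _ _ ψ)
                              (trans (subF-cong lifts-commute ψ) (sym (renF-subF _ _ ψ)))

subF-indAxiomBody : ∀ {k n} (φ : Formula (suc k)) {σ : Sub k n} {ts} → σ ≗ lookup ts
                  → subF σ (indPremise φ ⇒ ∀' φ)
                    ≡ (indPremise (instUnder φ ts) ⇒ ∀' (instUnder φ ts))
subF-indAxiomBody φ {σ} {ts} σ≗ =
  cong₂ _⇒_ (trans (subF-indPremise σ φ) (cong indPremise instance≡)) (cong ∀' instance≡)
  where
  instance≡ : subF (extS σ) φ ≡ instUnder φ ts
  instance≡ = subF-cong (λ { zero    → refl
                           ; (suc i) → trans (cong (renT suc) (σ≗ i)) (sym (lookup-renTs suc ts i)) })
                        φ

classAxiom-instance : ∀ A {n} {Γ : List (Formula n)} t us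
                    → Γ ⊢ (t ∈' tA A us) ⇔ inst (φA A) t us
classAxiom-instance A {Γ = Γ} t us =
  subst (Γ ⊢_) (subF-classAxiomBody A λ _ → refl)
        (∀^-elim (suc (arity A)) (classAxiomBody A) (axiom (cls A)) (lookup (t ∷ us)))

indAxiom-instance : ∀ {n} {Γ : List (Formula n)} k φ ts
                  → Γ ⊢ indPremise (instUnder φ ts) ⇒ ∀' (instUnder φ ts)
indAxiom-instance {Γ = Γ} k φ ts =
  subst (Γ ⊢_) (subF-indAxiomBody φ λ _ → refl)
        (∀^-elim k (indPremise φ ⇒ ∀' φ) (axiom (ind k φ)) (lookup ts))

Lookup⇒∈ : ∀ {n} {Γ : List (Formula n)} {x φ} → Lookup Γ x φ → φ ∈ Γ
Lookup⇒∈ here      = here refl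
Lookup⇒∈ (there l) = there (Lookup⇒∈ l)

sound : ∀ {n} {Γ : List (Formula n)} {O φ} → Γ ⊢λ O ∶ φ → Γ ⊢ φ
sound (tvar x)           = hyp (Lookup⇒∈ x)
sound (tplam M)          = ⇒I (sound M)
sound (tapp M N)         = ⇒E (sound M) (sound N)
sound (tpair M N)        = ∧I (sound M) (sound N)
sound (tfst M)           = ∧E₁ (sound M)
sound (tsnd M)           = ∧E₂ (sound M)
sound (tinl M)           = ∨I₁ (sound M)
sound (tinr M)           = ∨I₂ (sound M)
sound (tcase M N O)      = ∨E (sound M) (sound N) (sound O)
sound (tilam M)          = ∀I (sound M)
sound (tiapp M t)        = ∀E (sound M) t
sound (tpack t M)        = ∃I t (sound M)
sound (tlet M N)         = ∃E (sound M) (sound N)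
sound (tmagic M)         = ⊥E (sound M)
sound (taxRep A t us M)  = ⇒E (∧E₂ (classAxiom-instance A t us)) (sound M)
sound (taxProp A t us M) = ⇒E (∧E₁ (classAxiom-instance A t us)) (sound M)
sound (tind k φ ts M)    = ⇒E (indAxiom-instance k φ ts) (sound M)

classAxiom-typable : ∀ A → TypableInstances (suc (arity A)) (classAxiomBody A)
classAxiom-typable A Γ σ =
  subst (Typable Γ) (sym (subF-classAxiomBody A σ≗))
    ( pair (plam (t ∈' tA A us) (axProp A t us (pvar 0)))
           (plam (inst (φA A) t us) (axRep A t us (pvar 0)))
    , tpair (tplam (taxProp A t us (tvar here))) (tplam (taxRep A t us (tvar here))) )
  where
  t  = σ zero
  us = tabulate (σ ∘ suc)
  σ≗ : σ ≗ lookup (t ∷ us)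
  σ≗ zero    = refl
  σ≗ (suc i) = sym (lookup∘tabulate (σ ∘ suc) i)

indAxiom-typable : ∀ k (φ : Formula (suc k)) → TypableInstances k (indPremise φ ⇒ ∀' φ)
indAxiom-typable k φ Γ σ =
  subst (Typable Γ) (sym (subF-indAxiomBody φ (sym ∘ lookup∘tabulate σ)))
    ( plam (indPremise (instUnder φ ts)) (indP k φ ts (pvar 0))
    , tplam (tind k φ ts (tvar here)) )
  where
  ts = tabulate σ

axiom-typable : ∀ (A : Axiom) {n} (Γ : List (Formula n)) → Typable Γ (closeF (axiomF A))
axiom-typable (cls A)   = ∀^-typable (suc (arity A)) (classAxiomBody A) (classAxiom-typable A)
axiom-typable (ind k φ) = ∀^-typable k (indPremise φ ⇒ ∀' φ) (indAxiom-typable k φ)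

∈⇒Lookup : ∀ {n} {Γ : List (Formula n)} {φ} → φ ∈ Γ → Σ ℕ λ x → Lookup Γ x φ
∈⇒Lookup (here refl) = zero , here
∈⇒Lookup (there p)   = let (x , l) = ∈⇒Lookup p in suc x , there l

complete : ∀ {n} {Γ : List (Formula n)} {φ} → Γ ⊢ φ → Typable Γ φ
complete (hyp p)           = let (x , l) = ∈⇒Lookup p in pvar x , tvar l
complete {Γ = Γ} (axiom A) = axiom-typable A Γ
complete (⇒I {φ = φ} d)    = let (M , ⊢M) = complete d in plam φ M , tplam ⊢M
complete (⇒E d e)          = let (M , ⊢M) = complete d ; (N , ⊢N) = complete e in
                             app M N , tapp ⊢M ⊢N
complete (∧I d e)          = let (M , ⊢M) = complete d ; (N , ⊢N) = complete e in
                             pair M N , tpair ⊢M ⊢N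
complete (∧E₁ d)           = let (M , ⊢M) = complete d in fst M , tfst ⊢M
complete (∧E₂ d)           = let (M , ⊢M) = complete d in snd M , tsnd ⊢M
complete (∨I₁ d)           = let (M , ⊢M) = complete d in inl M , tinl ⊢M
complete (∨I₂ d)           = let (M , ⊢M) = complete d in inr M , tinr ⊢M
complete (∨E {φ = φ} {ψ} d e f) =
  let (M , ⊢M) = complete d ; (N , ⊢N) = complete e ; (O , ⊢O) = complete f in
  case M φ N ψ O , tcase ⊢M ⊢N ⊢O
complete (⊥E d)            = let (M , ⊢M) = complete d in magic M , tmagic ⊢M
complete (∀I d)            = let (M , ⊢M) = complete d in ilam M , tilam ⊢M
complete (∀E d t)          = let (M , ⊢M) = complete d in iapp M t , tiapp ⊢M t
complete (∃I t d)          = let (M , ⊢M) = complete d in pack t M , tpack t ⊢M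
complete (∃E {φ = φ} d e)  = let (M , ⊢M) = complete d ; (N , ⊢N) = complete e in
                             let∃ φ M N , tlet ⊢M ⊢N

lemma4p9 : ((n : ℕ) (Γ : List (Formula n)) (O : PTerm n) (φ : Formula n)
             → Γ ⊢λ O ∶ φ → Γ ⊢ φ)
           × ((n : ℕ) (Γ : List (Formula n)) (φ : Formula n)
             → Γ ⊢ φ → Σ (PTerm n) (λ M → Γ ⊢λ M ∶ φ))
lemma4p9 = (λ _ _ _ _ → sound) , (λ _ _ _ → complete)
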